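{- For every $m\ge 2$, the following patterns are all equivalent: (a) $12\cdots(m-1)m(m+1)$; (b) $12\cdots(m-1)m\,d$ for any $d\in[m]$; (c) $12\cdots(m-1)\,d\,m$ for any $d\in[m-1]$.
   Context: Partitions of $[n]$ are identified with canonical sequences $\pi_1\cdots\pi_n$ ($\pi_i=j$ iff $i$ lies in the $j$-th block, blocks ordered by increasing minima). A partition contains a pattern $\sigma$ if it has a subsequence order-isomorphic to $\sigma$, and avoids it otherwise; $p(n;\sigma)$ is the number of partitions of $[n]$ avoiding $\sigma$. Patterns $\sigma,\sigma'$ are equivalent if $p(n;\sigma)=p(n;\sigma')$ for all $n$. -}

module Defs where

open import Data.Nat using (ℕ; zero; suc; _+_; _∸_; _≤_; _⊔_; _<ᵇ_; _≤ᵇ_)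
open import Data.Bool using (Bool; true; false; _∧_; if_then_else_)
open import Data.Bool.Properties using () renaming (_≟_ to _≟B_)
open import Data.List using (List; []; _∷_; _++_; map; length; concatMap; upTo; zip)
open import Data.Bool.ListAction using (any; all)
open import Data.Product using (_×_; _,_)
open import Relation.Binary.PropositionalEquality using (_≡_)

-- Words are lists of positive naturals.

boolFilter : {A : Set} → (A → Bool) → List A → List A
boolFilter f [] = []
boolFilter f (x ∷ xs) = if f x then x ∷ boolFilter f xs else boolFilter f xs

eqB : Bool → Bool → Bool
eqB true true = true
eqB false false = true
eqB _ _ = false

-- This is exactly the
-- canonical sequence of a set partition (blocks ordered by minima).
canonicalFrom : ℕ → List ℕ → Bool
canonicalFrom mx [] = true
canonicalFrom mx (x ∷ xs) = (1 ≤ᵇ x) ∧ ((x ≤ᵇ suc mx) ∧ canonicalFrom (mx ⊔ x) xs)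

isCanonical : List ℕ → Bool
isCanonical = canonicalFrom 0

words : ℕ → ℕ → List (List ℕ)
words zero k = [] ∷ []
words (suc n) k = concatMap (λ x → map (x ∷_) (words n k)) (map suc (upTo k))

partitions : ℕ → List (List ℕ)
partitions n = boolFilter isCanonical (words n n)

subseqs : List ℕ → List (List ℕ)
subseqs [] = [] ∷ []
subseqs (x ∷ xs) = subseqs xs ++ map (x ∷_) (subseqs xs)

sameOrder : (ℕ × ℕ) → (ℕ × ℕ) → Bool
sameOrder (a , c) (b , d) = eqB (a <ᵇ b) (c <ᵇ d) ∧ eqB (b <ᵇ a) (d <ᵇ c)

orderIso : List ℕ → List ℕ → Bool
orderIso u v = (length u Data.Nat.≡ᵇ length v) ∧
  all (λ p → all (λ q → sameOrder p q) (zip u v)) (zip u v)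

contains : List ℕ → List ℕ → Bool
contains w σ = any (λ s → orderIso s σ) (subseqs w)

avoids : List ℕ → List ℕ → Bool
avoids w σ = if contains w σ then false else true

p : ℕ → List ℕ → ℕ
p n σ = length (boolFilter (λ w → avoids w σ) (partitions n))

Equivalent : List ℕ → List ℕ → Set
Equivalent σ σ' = ∀ n → p n σ ≡ p n σ'

incr : ℕ → List ℕ
incr k = map suc (upTo k)

patA : ℕ → List ℕ
patA m = incr (m + 1)

patB : ℕ → ℕ → List ℕ
patB m d = incr m ++ (d ∷ [])

patC : ℕ → ℕ → List ℕ
patC m d = incr (m ∸ 1) ++ (d ∷ m ∷ [])

module Submission where

-- Each of the three patterns is avoided by exactly the canonical words accepted by a
-- deterministic automaton that reads the word from left to right and remembers the number M
-- of blocks opened so far (for 1 2 ⋯ (m−1) d m also a threshold above which letters are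
-- forbidden). For all three automata the number g M L of accepted extensions of length L of a
-- prefix with M < m − 1 blocks satisfies g M (L+1) = M · g M L + g (M+1) L, and g (m−1) L = m ^ L:
-- for the first two patterns every step from m − 1 blocks on has exactly m admissible letters,
-- for the third this follows from an identity between the counts with and without a threshold.
-- These equations determine g 0 n, the number of avoiders of length n.

open import Defs
open import Data.Nat using (ℕ; zero; suc; _+_; _*_; _^_; _∸_; _≤_; _<_; _⊔_; _⊓_; _<ᵇ_; _≤ᵇ_; z≤n; s≤s)
open import Data.Nat.Properties
open import Data.Bool using (Bool; true; false; _∧_; if_then_else_; not; T)
open import Data.Bool.Properties using (T-≡; T-∧)
open import Data.List using (List; []; _∷_; _++_; map; length; concatMap; upTo; zip; applyUpTo; foldl; [_])
open import Data.List.Properties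
  using (length-map; length-++; map-++; map-∘; map-cong; map-cong-local; applyUpTo-∷ʳ; length-applyUpTo; foldl-++; ++-assoc; ++-identityʳ)
open import Data.Nat.ListAction using (sum)
open import Data.Nat.Tactic.RingSolver using (solve-∀)
open import Data.List.Membership.Propositional using (_∈_; find; lose)
open import Data.List.Membership.Propositional.Properties
  using (∈-++⁺ˡ; ∈-++⁺ʳ; ∈-++⁻; ∈-map⁺; ∈-map⁻; ∈-upTo⁺; ∈-upTo⁻)
open import Data.List.Relation.Unary.Any using (here; there)
open import Data.List.Relation.Unary.Any.Properties using (any⁺; any⁻)
open import Data.List.Relation.Unary.All using (lookup; tabulate)
open import Data.List.Relation.Unary.All.Properties using (all⁺; all⁻)
open import Data.List.Relation.Unary.AllPairs using (AllPairs; []; _∷_)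
import Data.List.Relation.Unary.AllPairs as AllPairs
import Data.List.Relation.Unary.AllPairs.Properties as AllPairsₚ
open import Data.List.Relation.Binary.Sublist.Propositional using (_⊆_; []; _∷_; _∷ʳ_; minimum)
  renaming (lookup to ⊆-lookup)
open import Data.List.Relation.Binary.Sublist.Propositional.Properties using (++⁺; ++⁺ʳ)
open import Data.Product using (_×_; _,_; ∃; ∃₂; proj₁; proj₂)
open import Data.Sum using (_⊎_; inj₁; inj₂)
open import Data.Maybe using (Maybe; nothing; just)
open import Data.Empty using (⊥-elim)
open import Function using (_∘_; id; Equivalence)
open import Relation.Binary.Core using (_Preserves_⟶_)
open import Relation.Binary.Definitions using (tri<; tri≈; tri>)
open import Relation.Binary.PropositionalEquality hiding ([_])
open import Relation.Nullary using (¬_; contradiction; yes; no)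

≤ᵇ≡true⇒≤ : ∀ {m n} → (m ≤ᵇ n) ≡ true → m ≤ n
≤ᵇ≡true⇒≤ {m} {n} e = ≤ᵇ⇒≤ m n (Equivalence.from T-≡ e)

≤⇒≤ᵇ≡true : ∀ {m n} → m ≤ n → (m ≤ᵇ n) ≡ true
≤⇒≤ᵇ≡true m≤n = Equivalence.to T-≡ (≤⇒≤ᵇ m≤n)

≤ᵇ≡false⇒> : ∀ {m n} → (m ≤ᵇ n) ≡ false → n < m
≤ᵇ≡false⇒> e = ≰⇒> (λ m≤n → subst T e (≤⇒≤ᵇ m≤n))

>⇒≤ᵇ≡false : ∀ {m n} → n < m → (m ≤ᵇ n) ≡ false
>⇒≤ᵇ≡false {m} {n} n<m with m ≤ᵇ n in e
... | false = refl
... | true = contradiction (≤ᵇ≡true⇒≤ e) (<⇒≱ n<m)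

∧≡true⁻ : ∀ {a b} → a ∧ b ≡ true → a ≡ true × b ≡ true
∧≡true⁻ {true} e = refl , e

∧≡true⁺ : ∀ {a b} → a ≡ true → b ≡ true → a ∧ b ≡ true
∧≡true⁺ refl refl = refl

∧≡false⁻ : ∀ {a b} → a ≡ true → a ∧ b ≡ false → b ≡ false
∧≡false⁻ refl e = e

T-eqB : ∀ {a b} → T (eqB a b) → a ≡ b
T-eqB {true} {true} _ = refl
T-eqB {false} {false} _ = refl

T-eqB-refl : ∀ b → T (eqB b b)
T-eqB-refl true = _
T-eqB-refl false = _

Occurs : List ℕ → List ℕ → Set
Occurs w σ = ∃ λ s → s ⊆ w × T (orderIso s σ)

⊆⇒∈subseqs : ∀ {xs ys} → xs ⊆ ys → xs ∈ subseqs ys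
⊆⇒∈subseqs [] = here refl
⊆⇒∈subseqs (y ∷ʳ τ) = ∈-++⁺ˡ (⊆⇒∈subseqs τ)
⊆⇒∈subseqs {ys = y ∷ ys} (refl ∷ τ) = ∈-++⁺ʳ (subseqs ys) (∈-map⁺ (y ∷_) (⊆⇒∈subseqs τ))

∈subseqs⇒⊆ : ∀ {xs} ys → xs ∈ subseqs ys → xs ⊆ ys
∈subseqs⇒⊆ [] (here refl) = []
∈subseqs⇒⊆ (y ∷ ys) xs∈ with ∈-++⁻ (subseqs ys) xs∈
... | inj₁ xs∈′ = y ∷ʳ ∈subseqs⇒⊆ ys xs∈′
... | inj₂ xs∈′ with ∈-map⁻ (y ∷_) xs∈′
...   | _ , xs∈″ , refl = refl ∷ ∈subseqs⇒⊆ ys xs∈″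

Occurs⇒contains : ∀ {w σ} → Occurs w σ → contains w σ ≡ true
Occurs⇒contains (s , τ , iso) = Equivalence.to T-≡ (any⁺ _ (lose (⊆⇒∈subseqs τ) iso))

contains⇒Occurs : ∀ w σ → contains w σ ≡ true → Occurs w σ
contains⇒Occurs w σ e with find (any⁻ _ (subseqs w) (Equivalence.from T-≡ e))
... | s , s∈ , iso = s , ∈subseqs⇒⊆ w s∈ , iso

split-⊆ : ∀ (v : List ℕ) {y c w} → v ++ y ∷ c ⊆ w → ∃₂ λ u r → w ≡ u ++ y ∷ r × v ⊆ u × c ⊆ r
split-⊆ [] (z ∷ʳ τ) with split-⊆ [] τ
... | u , r , refl , τ₁ , τ₂ = z ∷ u , r , refl , z ∷ʳ τ₁ , τ₂
split-⊆ [] (refl ∷ τ) = [] , _ , refl , [] , τ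
split-⊆ (x ∷ v) (z ∷ʳ τ) with split-⊆ (x ∷ v) τ
... | u , r , refl , τ₁ , τ₂ = z ∷ u , r , refl , z ∷ʳ τ₁ , τ₂
split-⊆ (x ∷ v) (refl ∷ τ) with split-⊆ v τ
... | u , r , refl , τ₁ , τ₂ = x ∷ u , r , refl , refl ∷ τ₁ , τ₂

split-length : ∀ n {k} (s : List ℕ) → length s ≡ n + k →
  ∃₂ λ v t → s ≡ v ++ t × length v ≡ n × length t ≡ k
split-length zero s e = [] , s , refl , refl , e
split-length (suc n) (x ∷ s) e with split-length n s (suc-injective e)
... | v , t , refl , ∣v∣ , ∣t∣ = x ∷ v , t , refl , cong suc ∣v∣ , ∣t∣

<⇒<ᵇ≡true : ∀ {m n} → m < n → (m <ᵇ n) ≡ true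
<⇒<ᵇ≡true m<n = Equivalence.to T-≡ (<⇒<ᵇ m<n)

≥⇒<ᵇ≡false : ∀ {m n} → n ≤ m → (m <ᵇ n) ≡ false
≥⇒<ᵇ≡false {m} {n} n≤m with m <ᵇ n in e
... | false = refl
... | true = contradiction (<ᵇ⇒< m n (Equivalence.from T-≡ e)) (≤⇒≯ n≤m)

<ᵇ-preserved : ∀ {f} → f Preserves _<_ ⟶ _<_ → ∀ a b → (f a <ᵇ f b) ≡ (a <ᵇ b)
<ᵇ-preserved {f} mono a b with <-cmp a b
... | tri< a<b _ _ = trans (<⇒<ᵇ≡true (mono a<b)) (sym (<⇒<ᵇ≡true a<b))
... | tri≈ _ refl _ = trans (≥⇒<ᵇ≡false (≤-refl {f a})) (sym (≥⇒<ᵇ≡false (≤-refl {a})))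
... | tri> _ _ b<a = trans (≥⇒<ᵇ≡false (<⇒≤ (mono b<a))) (sym (≥⇒<ᵇ≡false (<⇒≤ b<a)))

∈-zip-map : ∀ (f : ℕ → ℕ) σ {x a} → (x , a) ∈ zip (map f σ) σ → x ≡ f a
∈-zip-map f (b ∷ σ) (here refl) = refl
∈-zip-map f (b ∷ σ) (there p∈) = ∈-zip-map f σ p∈

orderIso-map : ∀ {f} → f Preserves _<_ ⟶ _<_ → ∀ σ → T (orderIso (map f σ) σ)
orderIso-map {f} mono σ = Equivalence.from T-∧
  (≡⇒≡ᵇ _ _ (length-map f σ) , all⁻ _ (tabulate λ p∈ → all⁻ _ (tabulate λ q∈ → consistent p∈ q∈)))
  where
  consistent : ∀ {p q} → p ∈ zip (map f σ) σ → q ∈ zip (map f σ) σ → T (sameOrder p q)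
  consistent {x , a} {y , b} p∈ q∈
    rewrite ∈-zip-map f σ p∈ | ∈-zip-map f σ q∈ | <ᵇ-preserved mono a b | <ᵇ-preserved mono b a =
    Equivalence.from T-∧ (T-eqB-refl (a <ᵇ b) , T-eqB-refl (b <ᵇ a))

orderIso⇒length : ∀ s σ → T (orderIso s σ) → length s ≡ length σ
orderIso⇒length s σ iso = ≡ᵇ⇒≡ _ _ (proj₁ (Equivalence.to T-∧ iso))

Consistent : List (ℕ × ℕ) → Set
Consistent ps = ∀ {p q} → p ∈ ps → q ∈ ps → T (sameOrder p q)

consistent-++ˡ : ∀ {ps} qs → Consistent (ps ++ qs) → Consistent ps
consistent-++ˡ qs c p∈ q∈ = c (∈-++⁺ˡ p∈) (∈-++⁺ˡ q∈)

orderIso⇒consistent : ∀ s σ → T (orderIso s σ) → Consistent (zip s σ)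
orderIso⇒consistent s σ iso p∈ q∈ =
  lookup (all⁺ _ _ (lookup (all⁺ _ _ (proj₂ (Equivalence.to T-∧ iso))) p∈)) q∈

sameOrder-< : ∀ {a α b β} → T (sameOrder (a , α) (b , β)) → α < β → a < b
sameOrder-< {a} {α} {b} {β} same α<β =
  <ᵇ⇒< a b (subst T (sym (T-eqB (proj₁ (Equivalence.to T-∧ same)))) (<⇒<ᵇ α<β))

sameOrder-≡ : ∀ {a α b} → T (sameOrder (a , α) (b , α)) → a ≡ b
sameOrder-≡ {a} {α} {b} same with Equivalence.to T-∧ same
... | a<ᵇb , b<ᵇa = ≤-antisym (not< (T-eqB b<ᵇa)) (not< (T-eqB a<ᵇb))
  where
  not< : ∀ {x y} → (x <ᵇ y) ≡ (α <ᵇ α) → y ≤ x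
  not< {x} {y} e = ≮⇒≥ (λ x<y → subst T (trans e (≥⇒<ᵇ≡false (≤-refl {α}))) (<⇒<ᵇ x<y))

zip-++ : ∀ (a b c d : List ℕ) → length a ≡ length b → zip (a ++ c) (b ++ d) ≡ zip a b ++ zip c d
zip-++ [] [] c d _ = refl
zip-++ (x ∷ a) (y ∷ b) c d e = cong ((x , y) ∷_) (zip-++ a b c d (suc-injective e))

∈-zip⁻ : ∀ {a α : ℕ} s σ → (a , α) ∈ zip s σ → a ∈ s × α ∈ σ
∈-zip⁻ (x ∷ s) (y ∷ σ) (here refl) = here refl , here refl
∈-zip⁻ (x ∷ s) (y ∷ σ) (there p∈) with ∈-zip⁻ s σ p∈
... | a∈ , α∈ = there a∈ , there α∈

∈-zip⁺ : ∀ {α : ℕ} s σ → length s ≡ length σ → α ∈ σ → ∃ λ (a : ℕ) → (a , α) ∈ zip s σ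
∈-zip⁺ (x ∷ s) (y ∷ σ) e (here refl) = x , here refl
∈-zip⁺ (x ∷ s) (y ∷ σ) e (there α∈) with ∈-zip⁺ s σ (suc-injective e) α∈
... | a , p∈ = a , there p∈

incr-suc : ∀ K → incr (suc K) ≡ incr K ++ [ suc K ]
incr-suc K = trans (cong (map suc) (sym (applyUpTo-∷ʳ id K))) (map-++ suc (upTo K) [ K ])

length-incr : ∀ K → length (incr K) ≡ K
length-incr K = trans (length-map suc (upTo K)) (length-applyUpTo id K)

∈-incr⁺ : ∀ {k} K → 1 ≤ k → k ≤ K → k ∈ incr K
∈-incr⁺ {suc i} K _ i<K = ∈-map⁺ suc (∈-upTo⁺ i<K)

∈-incr⁻ : ∀ {k} K → k ∈ incr K → 1 ≤ k × k ≤ K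
∈-incr⁻ K k∈ with ∈-map⁻ suc k∈
... | i , i∈ , refl = s≤s z≤n , ∈-upTo⁻ i∈

module Roles (v : List ℕ) (K : ℕ) (∣v∣ : length v ≡ K)
  (consistent : Consistent (zip v (incr K)))
  (positive : ∀ {a} → a ∈ v → 1 ≤ a) where

  Plays : ℕ → ℕ → Set
  Plays a k = (a , k) ∈ zip v (incr K)

  player : ∀ k → 1 ≤ k → k ≤ K → ∃ λ a → Plays a k
  player k 1≤k k≤K = ∈-zip⁺ v (incr K) (trans ∣v∣ (sym (length-incr K))) (∈-incr⁺ K 1≤k k≤K)

  role≤K : ∀ {a k} → Plays a k → k ≤ K
  role≤K a∈ = proj₂ (∈-incr⁻ K (proj₂ (∈-zip⁻ v (incr K) a∈)))

  player∈ : ∀ {a k} → Plays a k → a ∈ v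
  player∈ a∈ = proj₁ (∈-zip⁻ v (incr K) a∈)

  player≥role : ∀ k {a} → Plays a k → k ≤ a
  player≥role zero a∈ = z≤n
  player≥role (suc zero) a∈ = positive (player∈ a∈)
  player≥role (suc (suc k)) a∈ =
    let b , b∈ = player (suc k) (s≤s z≤n) (≤-trans (n≤1+n _) (role≤K a∈))
    in ≤-trans (s≤s (player≥role (suc k) b∈)) (sameOrder-< (consistent b∈ a∈) (n<1+n (suc k)))

  top-player : ∀ j {a k} → Plays a k → k + j ≡ K → ∃ λ b → Plays b K × a + j ≤ b
  top-player zero {a} a∈ k≡K = a , subst (Plays a) (trans (sym (+-identityʳ _)) k≡K) a∈ , ≤-reflexive (+-identityʳ a)
  top-player (suc j) {a} {k} a∈ k+j≡K
    with player (suc k) (s≤s z≤n) (subst (suc k ≤_) k+j≡K (subst (_≤ k + suc j) (+-comm k 1) (+-monoʳ-≤ k (s≤s z≤n))))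
  ... | a′ , a′∈ with top-player j a′∈ (trans (sym (+-suc k j)) k+j≡K)
  ...   | b , b∈ , a′+j≤b =
    b , b∈ , ≤-trans (≤-reflexive (+-suc a j))
                     (≤-trans (+-monoˡ-≤ j (sameOrder-< (consistent a∈ a′∈) (n<1+n k))) a′+j≤b)

occurrence-split : ∀ K τ {s} → T (orderIso s (incr K ++ τ)) →
  ∃₂ λ v t → s ≡ v ++ t × length v ≡ K × length t ≡ length τ × Consistent (zip v (incr K) ++ zip t τ)
occurrence-split K τ {s} iso
  with split-length K s (trans (orderIso⇒length s _ iso) (trans (length-++ (incr K)) (cong (_+ length τ) (length-incr K))))
... | v , t , refl , ∣v∣ , ∣t∣ = v , t , refl , ∣v∣ , ∣t∣ ,
  subst Consistent (zip-++ v (incr K) t τ (trans ∣v∣ (sym (length-incr K)))) (orderIso⇒consistent (v ++ t) (incr K ++ τ) iso)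

letter-after-run : ∀ {v K y d} ps → length v ≡ K → Consistent (zip v (incr K) ++ (y , d) ∷ ps) →
  (∀ {a} → a ∈ v → 1 ≤ a) → 1 ≤ d → ∀ {c} → d + c ≡ K →
  d ≤ y × ∃ λ b → (b , K) ∈ zip v (incr K) × y + c ≤ b
letter-after-run {v} {K} {y} {d} ps ∣v∣ consistent positive 1≤d {c} d+c≡K =
  subst (d ≤_) a≡y (player≥role d a-plays) , b , b-plays , subst (λ a → a + c ≤ b) a≡y a+c≤b
  where
  open Roles v K ∣v∣ (consistent-++ˡ _ consistent) positive
  d-player : ∃ λ a → Plays a d
  d-player = player d 1≤d (subst (d ≤_) d+c≡K (m≤m+n d c))
  a : ℕ
  a = proj₁ d-player
  a-plays : Plays a d
  a-plays = proj₂ d-player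
  a≡y : a ≡ y
  a≡y = sameOrder-≡ {α = d} (consistent (∈-++⁺ˡ a-plays) (∈-++⁺ʳ _ (here refl)))
  K-player : ∃ λ b → Plays b K × a + c ≤ b
  K-player = top-player c a-plays d+c≡K
  b : ℕ
  b = proj₁ K-player
  b-plays : Plays b K
  b-plays = proj₁ (proj₂ K-player)
  a+c≤b : a + c ≤ b
  a+c≤b = proj₂ (proj₂ K-player)

maxOf : ℕ → List ℕ → ℕ
maxOf = foldl _⊔_

init≤maxOf : ∀ a u → a ≤ maxOf a u
init≤maxOf a [] = ≤-refl
init≤maxOf a (x ∷ u) = ≤-trans (m≤m⊔n a x) (init≤maxOf (a ⊔ x) u)

∈⇒≤maxOf : ∀ a u {x} → x ∈ u → x ≤ maxOf a u
∈⇒≤maxOf a (y ∷ u) (here refl) = ≤-trans (m≤n⊔m a y) (init≤maxOf (a ⊔ y) u)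
∈⇒≤maxOf a (y ∷ u) (there x∈) = ∈⇒≤maxOf (a ⊔ y) u x∈

legal : ℕ → ℕ → Bool
legal M x = (1 ≤ᵇ x) ∧ (x ≤ᵇ suc M)

canonical-∷⁻ : ∀ M x w → canonicalFrom M (x ∷ w) ≡ true →
  legal M x ≡ true × canonicalFrom (M ⊔ x) w ≡ true
canonical-∷⁻ M x w c with 1 ≤ᵇ x | x ≤ᵇ suc M
... | true | true = refl , c

canonical-∷⁺ : ∀ M x w → legal M x ≡ true → canonicalFrom (M ⊔ x) w ≡ true →
  canonicalFrom M (x ∷ w) ≡ true
canonical-∷⁺ M x w l c with 1 ≤ᵇ x | x ≤ᵇ suc M
... | true | true = c

legal⇒≤suc : ∀ M x → legal M x ≡ true → x ≤ suc M
legal⇒≤suc M x l = ≤ᵇ≡true⇒≤ (proj₂ (∧≡true⁻ {1 ≤ᵇ x} l))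

canonical-++⁻ : ∀ a u w → canonicalFrom a (u ++ w) ≡ true → canonicalFrom a u ≡ true
canonical-++⁻ a [] w c = refl
canonical-++⁻ a (x ∷ u) w c with canonical-∷⁻ a x (u ++ w) c
... | l , c′ = canonical-∷⁺ a x u l (canonical-++⁻ (a ⊔ x) u w c′)

canonical-last : ∀ a u x → canonicalFrom a (u ++ [ x ]) ≡ true → x ≤ suc (maxOf a u)
canonical-last a [] x c = legal⇒≤suc a x (proj₁ (canonical-∷⁻ a x [] c))
canonical-last a (y ∷ u) x c = canonical-last (a ⊔ y) u x (proj₂ (canonical-∷⁻ a y (u ++ [ x ]) c))

-- The first occurrences of a+1, a+2, … appear in increasing order.
increasing⊆canonical : ∀ a p {v} → canonicalFrom a p ≡ true → AllPairs _<_ v →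
  (∀ {y} → y ∈ v → a < y × y ≤ maxOf a p) → v ⊆ p
increasing⊆canonical a [] {[]} _ _ _ = []
increasing⊆canonical a [] {y ∷ v} _ _ bounds = ⊥-elim (<⇒≱ (proj₁ (bounds (here refl))) (proj₂ (bounds (here refl))))
increasing⊆canonical a (x ∷ p) c inc bounds with canonical-∷⁻ a x p c
... | l , c′ with m≤n⇒m<n∨m≡n (legal⇒≤suc a x l)
...   | inj₁ (s≤s x≤a) =
  x ∷ʳ increasing⊆canonical (a ⊔ x) p c′ inc
         (λ y∈ → subst (_< _) (sym (m≥n⇒m⊔n≡m x≤a)) (proj₁ (bounds y∈)) , proj₂ (bounds y∈))
...   | inj₂ refl = new-block inc bounds
  where
  a⊔suc-a : a ⊔ suc a ≡ suc a
  a⊔suc-a = m≤n⇒m⊔n≡n (n≤1+n a)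
  new-block : ∀ {v} → AllPairs _<_ v → (∀ {y} → y ∈ v → a < y × y ≤ maxOf a (suc a ∷ p)) → v ⊆ suc a ∷ p
  new-block [] _ = minimum _
  new-block {y ∷ v} (y<v ∷ inc′) bounds with m≤n⇒m<n∨m≡n (proj₁ (bounds (here refl)))
  ... | inj₂ refl = refl ∷ increasing⊆canonical (a ⊔ suc a) p c′ inc′
          (λ z∈ → subst (_< _) (sym a⊔suc-a) (lookup y<v z∈) , proj₂ (bounds (there z∈)))
  ... | inj₁ suc-a<y = suc a ∷ʳ increasing⊆canonical (a ⊔ suc a) p c′ (y<v ∷ inc′)
          (λ z∈ → subst (_< _) (sym a⊔suc-a) (above z∈) , proj₂ (bounds z∈))
    where
    above : ∀ {z} → z ∈ y ∷ v → suc a < z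
    above (here refl) = suc-a<y
    above (there z∈) = <-trans suc-a<y (lookup y<v z∈)

increasing-map : ∀ {f} → f Preserves _<_ ⟶ _<_ → ∀ {xs} → AllPairs _<_ xs → AllPairs _<_ (map f xs)
increasing-map mono xs< = AllPairsₚ.map⁺ (AllPairs.map mono xs<)

increasing-incr : ∀ K → AllPairs _<_ (incr K)
increasing-incr K = increasing-map s≤s (AllPairsₚ.applyUpTo⁺₁ id K (λ i<j _ → i<j))

staircase⊆canonical : ∀ u k K → canonicalFrom 0 u ≡ true → K + k ≤ maxOf 0 u → map (_+ k) (incr K) ⊆ u
staircase⊆canonical u k K c K+k≤max =
  increasing⊆canonical 0 u c (increasing-map (+-monoˡ-< k) (increasing-incr K)) bounds
  where
  bounds : ∀ {y} → y ∈ map (_+ k) (incr K) → 0 < y × y ≤ maxOf 0 u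
  bounds y∈ with ∈-map⁻ (_+ k) y∈
  ... | i , i∈ , refl with ∈-incr⁻ K i∈
  ...   | 1≤i , i≤K = ≤-trans 1≤i (m≤m+n i k) , ≤-trans (+-monoˡ-≤ k i≤K) K+k≤max

staircase-then-letter : ∀ u r x k K j → canonicalFrom 0 u ≡ true → K + k ≤ maxOf 0 u → j + k ≡ x →
  Occurs (u ++ x ∷ r) (incr K ++ [ j ])
staircase-then-letter u r x k K j c K+k≤max j+k≡x =
  map (_+ k) (incr K ++ [ j ]) ,
  subst (_⊆ u ++ x ∷ r) (sym shifted) (++⁺ (staircase⊆canonical u k K c K+k≤max) (refl ∷ minimum r)) ,
  orderIso-map (+-monoˡ-< k) (incr K ++ [ j ])
  where
  shifted : map (_+ k) (incr K ++ [ j ]) ≡ map (_+ k) (incr K) ++ [ x ]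
  shifted = trans (map-++ (_+ k) (incr K) [ j ]) (cong (λ z → map (_+ k) (incr K) ++ [ z ]) j+k≡x)

sumBelow : (ℕ → ℕ) → ℕ → ℕ
sumBelow h zero = 0
sumBelow h (suc k) = h 0 + sumBelow (h ∘ suc) k

sumBelow-+ : ∀ h a b → sumBelow h (a + b) ≡ sumBelow h a + sumBelow (λ i → h (a + i)) b
sumBelow-+ h zero b = refl
sumBelow-+ h (suc a) b = trans (cong (h 0 +_) (sumBelow-+ (h ∘ suc) a b)) (sym (+-assoc (h 0) _ _))

sumBelow-cong : ∀ h g k → (∀ i → i < k → h i ≡ g i) → sumBelow h k ≡ sumBelow g k
sumBelow-cong h g zero h≡g = refl
sumBelow-cong h g (suc k) h≡g =
  cong₂ _+_ (h≡g 0 (s≤s z≤n)) (sumBelow-cong (h ∘ suc) (g ∘ suc) k (λ i i<k → h≡g (suc i) (s≤s i<k)))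

sumBelow-const : ∀ h k v → (∀ i → i < k → h i ≡ v) → sumBelow h k ≡ k * v
sumBelow-const h zero v _ = refl
sumBelow-const h (suc k) v h≡v =
  cong₂ _+_ (h≡v 0 (s≤s z≤n)) (sumBelow-const (h ∘ suc) k v (λ i i<k → h≡v (suc i) (s≤s i<k)))

sumBelow-suc : ∀ h k → sumBelow h (suc k) ≡ sumBelow h k + h k
sumBelow-suc h k = begin
  sumBelow h (suc k)                  ≡⟨ cong (sumBelow h) (+-comm 1 k) ⟩
  sumBelow h (k + 1)                  ≡⟨ sumBelow-+ h k 1 ⟩
  sumBelow h k + (h (k + 0) + 0)      ≡⟨ cong (λ z → sumBelow h k + (h z + 0)) (+-identityʳ k) ⟩
  sumBelow h k + (h k + 0)            ≡⟨ cong (sumBelow h k +_) (+-identityʳ (h k)) ⟩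
  sumBelow h k + h k                  ∎
  where open ≡-Reasoning

sumBelow-vanishing : ∀ h K k → K ≤ k → (∀ i → K ≤ i → h i ≡ 0) → sumBelow h k ≡ sumBelow h K
sumBelow-vanishing h K k K≤k h≡0 with m≤n⇒∃[o]m+o≡n K≤k
... | o , refl = begin
  sumBelow h (K + o)                              ≡⟨ sumBelow-+ h K o ⟩
  sumBelow h K + sumBelow (λ i → h (K + i)) o
    ≡⟨ cong (sumBelow h K +_) (sumBelow-const _ o 0 (λ i _ → h≡0 (K + i) (m≤m+n K i))) ⟩
  sumBelow h K + o * 0                            ≡⟨ cong (sumBelow h K +_) (*-zeroʳ o) ⟩
  sumBelow h K + 0                                ≡⟨ +-identityʳ _ ⟩
  sumBelow h K                                    ∎
  where open ≡-Reasoning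

sumBelow-+₃ : ∀ h a b c → sumBelow h (a + (b + c)) ≡
  sumBelow h a + (sumBelow (λ i → h (a + i)) b + sumBelow (λ i → h (a + (b + i))) c)
sumBelow-+₃ h a b c = trans (sumBelow-+ h a (b + c)) (cong (sumBelow h a +_) (sumBelow-+ (λ i → h (a + i)) b c))

sumBelow-if : ∀ (b : ℕ → Bool) v k →
  sumBelow (λ i → if b i then v else 0) k ≡ sumBelow (λ i → if b i then 1 else 0) k * v
sumBelow-if b v zero = refl
sumBelow-if b v (suc k) with b 0
... | true = cong (v +_) (sumBelow-if (b ∘ suc) v k)
... | false = sumBelow-if (b ∘ suc) v k

-- Counting automata on canonical words

boolFilter-++ : ∀ {A : Set} (P : A → Bool) a b → boolFilter P (a ++ b) ≡ boolFilter P a ++ boolFilter P b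
boolFilter-++ P [] b = refl
boolFilter-++ P (x ∷ a) b with P x
... | true = cong (x ∷_) (boolFilter-++ P a b)
... | false = boolFilter-++ P a b

boolFilter-boolFilter : ∀ {A : Set} (P Q : A → Bool) xs →
  boolFilter P (boolFilter Q xs) ≡ boolFilter (λ x → Q x ∧ P x) xs
boolFilter-boolFilter P Q [] = refl
boolFilter-boolFilter P Q (x ∷ xs) with Q x
... | false = boolFilter-boolFilter P Q xs
... | true with P x
...   | true = cong (x ∷_) (boolFilter-boolFilter P Q xs)
...   | false = boolFilter-boolFilter P Q xs

boolFilter-cong : ∀ {A : Set} {P Q : A → Bool} → (∀ x → P x ≡ Q x) → ∀ xs → boolFilter P xs ≡ boolFilter Q xs
boolFilter-cong P≡Q [] = refl
boolFilter-cong {Q = Q} P≡Q (x ∷ xs) rewrite P≡Q x with Q x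
... | true = cong (x ∷_) (boolFilter-cong P≡Q xs)
... | false = boolFilter-cong P≡Q xs

length-boolFilter-concatMap : ∀ {A B : Set} (P : B → Bool) (F : A → List B) xs →
  length (boolFilter P (concatMap F xs)) ≡ sum (map (λ x → length (boolFilter P (F x))) xs)
length-boolFilter-concatMap P F [] = refl
length-boolFilter-concatMap P F (x ∷ xs) = begin
  length (boolFilter P (F x ++ concatMap F xs))                    ≡⟨ cong length (boolFilter-++ P (F x) _) ⟩
  length (boolFilter P (F x) ++ boolFilter P (concatMap F xs))      ≡⟨ length-++ (boolFilter P (F x)) ⟩
  length (boolFilter P (F x)) + length (boolFilter P (concatMap F xs))
    ≡⟨ cong (length (boolFilter P (F x)) +_) (length-boolFilter-concatMap P F xs) ⟩
  length (boolFilter P (F x)) + sum (map (λ x → length (boolFilter P (F x))) xs) ∎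
  where open ≡-Reasoning

sum-map-applyUpTo : ∀ (g f : ℕ → ℕ) k → sum (map g (applyUpTo f k)) ≡ sumBelow (g ∘ f) k
sum-map-applyUpTo g f zero = refl
sum-map-applyUpTo g f (suc k) = cong (g (f 0) +_) (sum-map-applyUpTo g (f ∘ suc) k)

sum-map-incr : ∀ (g : ℕ → ℕ) k → sum (map g (incr k)) ≡ sumBelow (g ∘ suc) k
sum-map-incr g k = trans (cong sum (sym (map-∘ (upTo k)))) (sum-map-applyUpTo (g ∘ suc) id k)

module CanonicalAutomaton {S : Set} (blocks : S → ℕ) (allowed : S → ℕ → Bool) (next : S → ℕ → S)
  (blocks-next : ∀ s x → blocks (next s x) ≡ blocks s ⊔ x) where

  admissible : S → ℕ → Bool
  admissible s x = legal (blocks s) x ∧ allowed s x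

  accepts : S → List ℕ → Bool
  accepts s [] = true
  accepts s (x ∷ w) = admissible s x ∧ accepts (next s x) w

  run : S → List ℕ → S
  run = foldl next

  blocks-run : ∀ s u → blocks (run s u) ≡ maxOf (blocks s) u
  blocks-run s [] = refl
  blocks-run s (x ∷ u) = trans (blocks-run (next s x) u) (cong (λ b → maxOf b u) (blocks-next s x))

  accepts-++⁻ : ∀ s u w → accepts s (u ++ w) ≡ true → accepts s u ≡ true × accepts (run s u) w ≡ true
  accepts-++⁻ s [] w acc = refl , acc
  accepts-++⁻ s (x ∷ u) w acc with ∧≡true⁻ {admissible s x} acc
  ... | ok , acc′ with accepts-++⁻ (next s x) u w acc′
  ...   | acc-u , acc-w = ∧≡true⁺ ok acc-u , acc-w

  accepts⇒allowed : ∀ s u x r → accepts s (u ++ x ∷ r) ≡ true → allowed (run s u) x ≡ true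
  accepts⇒allowed s u x r acc =
    proj₂ (∧≡true⁻ {legal _ x} (proj₁ (∧≡true⁻ {admissible _ x} (proj₂ (accepts-++⁻ s u (x ∷ r) acc)))))

  accepted-letters : (P : ℕ → Set) → (∀ s x → admissible s x ≡ true → P x) →
    ∀ s w {x} → accepts s w ≡ true → x ∈ w → P x
  accepted-letters P admissible⇒P s (y ∷ w) acc (here refl) = admissible⇒P s y (proj₁ (∧≡true⁻ acc))
  accepted-letters P admissible⇒P s (y ∷ w) acc (there x∈) =
    accepted-letters P admissible⇒P (next s y) w (proj₂ (∧≡true⁻ {admissible s y} acc)) x∈

  accepted-positive : ∀ s w {x} → accepts s w ≡ true → x ∈ w → 1 ≤ x
  accepted-positive = accepted-letters (1 ≤_)
    λ s x ok → ≤ᵇ≡true⇒≤ (proj₁ (∧≡true⁻ (proj₁ (∧≡true⁻ {legal (blocks s) x} ok))))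

  accepts⇒canonical : ∀ s w → accepts s w ≡ true → canonicalFrom (blocks s) w ≡ true
  accepts⇒canonical s [] acc = refl
  accepts⇒canonical s (x ∷ w) acc with ∧≡true⁻ {admissible s x} acc
  ... | ok , acc′ = canonical-∷⁺ (blocks s) x w (proj₁ (∧≡true⁻ {legal (blocks s) x} ok))
        (subst (λ b → canonicalFrom b w ≡ true) (blocks-next s x) (accepts⇒canonical (next s x) w acc′))

  rejected-split : ∀ s w → canonicalFrom (blocks s) w ≡ true → accepts s w ≡ false →
    ∃₂ λ u x → ∃ λ r → w ≡ u ++ x ∷ r × accepts s u ≡ true × allowed (run s u) x ≡ false ×
      canonicalFrom (blocks s) (u ++ [ x ]) ≡ true
  rejected-split s (x ∷ w) c rej with canonical-∷⁻ (blocks s) x w c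
  ... | l , c′ with allowed s x in a
  ...   | false = [] , x , w , refl , refl , a , canonical-∷⁺ (blocks s) x [] l refl
  ...   | true with rejected-split (next s x) w (subst (λ b → canonicalFrom b w ≡ true) (sym (blocks-next s x)) c′)
                     (∧≡false⁻ (∧≡true⁺ l refl) rej)
  ...     | u , y , r , refl , acc-u , forbidden , c-uy =
    x ∷ u , y , r , refl , ∧≡true⁺ (∧≡true⁺ l a) acc-u , forbidden ,
    canonical-∷⁺ (blocks s) x (u ++ [ y ]) l (subst (λ b → canonicalFrom b (u ++ [ y ]) ≡ true) (blocks-next s x) c-uy)

  count : S → ℕ → ℕ
  countVia : S → ℕ → ℕ → ℕ
  count s zero = 1
  count s (suc L) = sumBelow (λ i → countVia s (suc i) L) (suc (blocks s))
  countVia s x L = if allowed s x then count (next s x) L else 0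

  accepted-∷-admissible : ∀ {s x} → admissible s x ≡ true → ∀ ws →
    boolFilter (accepts s) (map (x ∷_) ws) ≡ map (x ∷_) (boolFilter (accepts (next s x)) ws)
  accepted-∷-admissible ok [] = refl
  accepted-∷-admissible {s} {x} ok (w ∷ ws) rewrite ok with accepts (next s x) w
  ... | true = cong ((x ∷ w) ∷_) (accepted-∷-admissible ok ws)
  ... | false = accepted-∷-admissible ok ws

  accepted-∷-inadmissible : ∀ {s x} → admissible s x ≡ false → ∀ ws → boolFilter (accepts s) (map (x ∷_) ws) ≡ []
  accepted-∷-inadmissible ok [] = refl
  accepted-∷-inadmissible ok (w ∷ ws) rewrite ok = accepted-∷-inadmissible ok ws

  length-accepted-∷ : ∀ s x ws → length (boolFilter (accepts s) (map (x ∷_) ws)) ≡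
    (if admissible s x then length (boolFilter (accepts (next s x)) ws) else 0)
  length-accepted-∷ s x ws with admissible s x in ok
  ... | true = trans (cong length (accepted-∷-admissible ok ws)) (length-map (x ∷_) (boolFilter (accepts (next s x)) ws))
  ... | false = cong length (accepted-∷-inadmissible ok ws)

  -- The alphabet bound k is irrelevant once it exceeds every letter an accepted word can use.
  length-accepted : ∀ L s k → blocks s + L ≤ k → length (boolFilter (accepts s) (words L k)) ≡ count s L
  length-accepted zero s k _ = refl
  length-accepted (suc L) s k bound = begin
    length (boolFilter (accepts s) (words (suc L) k))
      ≡⟨ length-boolFilter-concatMap (accepts s) (λ x → map (x ∷_) (words L k)) (incr k) ⟩
    sum (map (λ x → length (boolFilter (accepts s) (map (x ∷_) (words L k)))) (incr k))
      ≡⟨ cong sum (map-cong (λ x → length-accepted-∷ s x (words L k)) (incr k)) ⟩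
    sum (map G (incr k))
      ≡⟨ sum-map-incr G k ⟩
    sumBelow (G ∘ suc) k
      ≡⟨ sumBelow-vanishing (G ∘ suc) (suc (blocks s)) k 1+blocks≤k beyond ⟩
    sumBelow (G ∘ suc) (suc (blocks s))
      ≡⟨ sumBelow-cong _ _ (suc (blocks s)) within ⟩
    count s (suc L) ∎
    where
    open ≡-Reasoning
    G : ℕ → ℕ
    G x = if admissible s x then length (boolFilter (accepts (next s x)) (words L k)) else 0
    1+blocks≤k : suc (blocks s) ≤ k
    1+blocks≤k = ≤-trans (s≤s (m≤m+n _ L)) (subst (_≤ k) (+-suc _ L) bound)
    beyond : ∀ i → suc (blocks s) ≤ i → G (suc i) ≡ 0
    beyond i i>M rewrite >⇒≤ᵇ≡false {suc i} {suc (blocks s)} (s≤s i>M) = refl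
    within : ∀ i → i < suc (blocks s) → G (suc i) ≡ countVia s (suc i) L
    within i i≤M rewrite ≤⇒≤ᵇ≡true i≤M =
      cong (λ n → if allowed s (suc i) then n else 0) (length-accepted L (next s (suc i)) k next-bound)
      where
      next-bound : blocks (next s (suc i)) + L ≤ k
      next-bound = ≤-trans (+-monoˡ-≤ L (subst (_≤ suc (blocks s)) (sym (blocks-next s (suc i))) (⊔-lub (n≤1+n _) i≤M)))
                           (subst (_≤ k) (+-suc _ L) bound)

  record Recognizes (s₀ : S) (σ : List ℕ) : Set where
    field
      starts-empty : blocks s₀ ≡ 0
      accepted-avoids : ∀ w → accepts s₀ w ≡ true → ¬ Occurs w σ
      rejected-contains : ∀ w → isCanonical w ≡ true → accepts s₀ w ≡ false → Occurs w σ

  recognized-avoiders : ∀ {s₀ σ} → Recognizes s₀ σ → ∀ w → (isCanonical w ∧ avoids w σ) ≡ accepts s₀ w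
  recognized-avoiders {s₀} {σ} R w with accepts s₀ w in acc
  ... | true rewrite subst (λ b → canonicalFrom b w ≡ true) (Recognizes.starts-empty R) (accepts⇒canonical s₀ w acc)
    with contains w σ in occ
  ...   | true = ⊥-elim (Recognizes.accepted-avoids R w acc (contains⇒Occurs w σ occ))
  ...   | false = refl
  recognized-avoiders {s₀} {σ} R w | false with isCanonical w in can
  ... | false = refl
  ... | true rewrite Occurs⇒contains (Recognizes.rejected-contains R w can acc) = refl

  avoiders-count : ∀ {s₀ σ} → Recognizes s₀ σ → ∀ n → p n σ ≡ count s₀ n
  avoiders-count {s₀} {σ} R n = begin
    p n σ
      ≡⟨ cong length (boolFilter-boolFilter (λ w → avoids w σ) isCanonical (words n n)) ⟩
    length (boolFilter (λ w → isCanonical w ∧ avoids w σ) (words n n))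
      ≡⟨ cong length (boolFilter-cong (recognized-avoiders R) (words n n)) ⟩
    length (boolFilter (accepts s₀) (words n n))
      ≡⟨ length-accepted n s₀ n (≤-reflexive (cong (_+ n) (Recognizes.starts-empty R))) ⟩
    count s₀ n ∎
    where open ≡-Reasoning

  count-suc : ∀ s L →
    count s (suc L) ≡ sumBelow (λ i → countVia s (suc i) L) (blocks s) + countVia s (suc (blocks s)) L
  count-suc s L = sumBelow-suc _ (blocks s)

  countVia-allowed : ∀ {s x} L → allowed s x ≡ true → countVia s x L ≡ count (next s x) L
  countVia-allowed L a rewrite a = refl

  countVia-forbidden : ∀ {s x} L → allowed s x ≡ false → countVia s x L ≡ 0
  countVia-forbidden L a rewrite a = refl

  count-old-letters : ∀ s L → (∀ i → i < blocks s → countVia s (suc i) L ≡ count s L) →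
    count s (suc L) ≡ blocks s * count s L + countVia s (suc (blocks s)) L
  count-old-letters s L old =
    trans (count-suc s L) (cong (_+ countVia s (suc (blocks s)) L) (sumBelow-const _ (blocks s) (count s L) old))

[m∸1]*n+n≡m*n : ∀ {m} n → 1 ≤ m → (m ∸ 1) * n + n ≡ m * n
[m∸1]*n+n≡m*n {suc m} n _ = +-comm (m * n) n

x+c≡d+c+[x∸d] : ∀ {d x} c → d ≤ x → x + c ≡ d + c + (x ∸ d)
x+c≡d+c+[x∸d] {d} {x} c d≤x = begin
  x + c                ≡⟨ cong (_+ c) (sym (m+[n∸m]≡n d≤x)) ⟩
  d + (x ∸ d) + c      ≡⟨ +-assoc d (x ∸ d) c ⟩
  d + ((x ∸ d) + c)    ≡⟨ cong (d +_) (+-comm (x ∸ d) c) ⟩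
  d + (c + (x ∸ d))    ≡⟨ sym (+-assoc d c (x ∸ d)) ⟩
  d + c + (x ∸ d)      ∎
  where open ≡-Reasoning

-- g M L stands for the number of ways to append L letters to a canonical prefix with M blocks:
-- each letter reuses one of the M blocks or opens block M + 1.
record ExtensionCount (m : ℕ) (g : ℕ → ℕ → ℕ) : Set where
  field
    empty : ∀ M → g M 0 ≡ 1
    unsaturated : ∀ M L → M < m ∸ 1 → g M (suc L) ≡ M * g M L + g (suc M) L
    saturated : ∀ L → g (m ∸ 1) L ≡ m ^ L

extensionCount-unique : ∀ {m g g′} → ExtensionCount m g → ExtensionCount m g′ →
  ∀ L M → M ≤ m ∸ 1 → g M L ≡ g′ M L
extensionCount-unique G G′ zero M _ = trans (ExtensionCount.empty G M) (sym (ExtensionCount.empty G′ M))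
extensionCount-unique {m} {g} {g′} G G′ (suc L) M M≤q with m≤n⇒m<n∨m≡n M≤q
... | inj₂ refl = trans (ExtensionCount.saturated G (suc L)) (sym (ExtensionCount.saturated G′ (suc L)))
... | inj₁ M<q = begin
  g M (suc L)                ≡⟨ ExtensionCount.unsaturated G M L M<q ⟩
  M * g M L + g (suc M) L
    ≡⟨ cong₂ (λ a b → M * a + b) (extensionCount-unique G G′ L M M≤q) (extensionCount-unique G G′ L (suc M) M<q) ⟩
  M * g′ M L + g′ (suc M) L  ≡⟨ sym (ExtensionCount.unsaturated G′ M L M<q) ⟩
  g′ M (suc L)               ∎
  where open ≡-Reasoning

CountedBy : ℕ → List ℕ → Set
CountedBy m σ = ∃ λ g → ExtensionCount m g × ∀ n → p n σ ≡ g 0 n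

countedBy-equivalent : ∀ {m σ σ′} → CountedBy m σ → CountedBy m σ′ → Equivalent σ σ′
countedBy-equivalent (g , G , p≡g) (g′ , G′ , p≡g′) n =
  trans (p≡g n) (trans (extensionCount-unique G G′ n 0 z≤n) (sym (p≡g′ n)))

-- Pattern 1 2 ⋯ m (m+1)

module PatternA (m : ℕ) where

  open CanonicalAutomaton {ℕ} id (λ _ x → x ≤ᵇ m) _⊔_ (λ _ _ → refl)

  incr-m+1 : incr (m + 1) ≡ incr m ++ [ suc m ]
  incr-m+1 = trans (cong incr (+-comm m 1)) (incr-suc m)

  accepted-avoids : ∀ w → accepts 0 w ≡ true → ¬ Occurs w (patA m)
  accepted-avoids w acc (s , s⊆w , iso) =
    <⇒≱ (s≤s (letters≤m (⊆-lookup s⊆w (player∈ a-plays)))) (subst (_≤ a) (+-comm m 1) (player≥role (m + 1) a-plays))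
    where
    letters≤m : ∀ {x} → x ∈ w → x ≤ m
    letters≤m = accepted-letters (_≤ m) (λ M x ok → ≤ᵇ≡true⇒≤ (proj₂ (∧≡true⁻ {legal M x} ok))) 0 w acc
    open Roles s (m + 1) (trans (orderIso⇒length s _ iso) (length-incr (m + 1))) (orderIso⇒consistent s _ iso)
      (λ a∈ → accepted-positive 0 w acc (⊆-lookup s⊆w a∈))
    top : ∃ λ a → Plays a (m + 1)
    top = player (m + 1) (subst (1 ≤_) (+-comm 1 m) (s≤s z≤n)) ≤-refl
    a : ℕ
    a = proj₁ top
    a-plays : Plays a (m + 1)
    a-plays = proj₂ top

  rejected-contains : ∀ w → isCanonical w ≡ true → accepts 0 w ≡ false → Occurs w (patA m)
  rejected-contains w c rej with rejected-split 0 w c rej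
  ... | u , x , r , refl , _ , forbidden , c-ux = subst (Occurs (u ++ x ∷ r)) (sym incr-m+1)
    (staircase-then-letter u r x k m (suc m) (canonical-++⁻ 0 u [ x ] c-ux) m+k≤max (m+[n∸m]≡n m<x))
    where
    m<x : m < x
    m<x = ≤ᵇ≡false⇒> forbidden
    k : ℕ
    k = x ∸ suc m
    m+k≤max : m + k ≤ maxOf 0 u
    m+k≤max = ≤-pred (subst (_≤ suc (maxOf 0 u)) (sym (m+[n∸m]≡n m<x)) (canonical-last 0 u x c-ux))

  recognizes : Recognizes 0 (patA m)
  recognizes = record { starts-empty = refl ; accepted-avoids = accepted-avoids ; rejected-contains = rejected-contains }

  countVia-old : ∀ {M} L i → i < M → M ≤ m → countVia M (suc i) L ≡ count M L
  countVia-old L i i<M M≤m rewrite ≤⇒≤ᵇ≡true (≤-trans i<M M≤m) | m≥n⇒m⊔n≡m i<M = refl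

  count-unsaturated : ∀ M L → M < m → count M (suc L) ≡ M * count M L + count (suc M) L
  count-unsaturated M L M<m = trans (count-old-letters M L (λ i i<M → countVia-old L i i<M (<⇒≤ M<m)))
    (cong (M * count M L +_)
          (trans (countVia-allowed L (≤⇒≤ᵇ≡true M<m)) (cong (λ b → count b L) (m≤n⇒m⊔n≡n (n≤1+n M)))))

  count-full : ∀ L → count m L ≡ m ^ L
  count-full zero = refl
  count-full (suc L) = begin
    count m (suc L)                       ≡⟨ count-old-letters m L (λ i i<m → countVia-old L i i<m ≤-refl) ⟩
    m * count m L + countVia m (suc m) L
      ≡⟨ cong₂ (λ a b → m * a + b) (count-full L) (countVia-forbidden L (>⇒≤ᵇ≡false (≤-refl {suc m}))) ⟩
    m * m ^ L + 0                         ≡⟨ +-identityʳ _ ⟩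
    m ^ suc L                             ∎
    where open ≡-Reasoning

  extensionCount : 1 ≤ m → ExtensionCount m count
  extensionCount 1≤m = record
    { empty = λ _ → refl
    ; unsaturated = λ M L M<q → count-unsaturated M L (<-≤-trans M<q (m∸n≤m m 1))
    ; saturated = saturated
    }
    where
    q+1≡m : suc (m ∸ 1) ≡ m
    q+1≡m = m+[n∸m]≡n 1≤m
    saturated : ∀ L → count (m ∸ 1) L ≡ m ^ L
    saturated zero = refl
    saturated (suc L) = begin
      count (m ∸ 1) (suc L)                                   ≡⟨ count-unsaturated (m ∸ 1) L (subst (m ∸ 1 <_) q+1≡m (n<1+n _)) ⟩
      (m ∸ 1) * count (m ∸ 1) L + count (suc (m ∸ 1)) L       ≡⟨ cong₂ (λ a b → (m ∸ 1) * a + count b L) (saturated L) q+1≡m ⟩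
      (m ∸ 1) * m ^ L + count m L                             ≡⟨ cong ((m ∸ 1) * m ^ L +_) (count-full L) ⟩
      (m ∸ 1) * m ^ L + m ^ L                                 ≡⟨ [m∸1]*n+n≡m*n (m ^ L) 1≤m ⟩
      m ^ suc L                                               ∎
      where open ≡-Reasoning

  countedBy : 1 ≤ m → CountedBy m (patA m)
  countedBy 1≤m = count , extensionCount 1≤m , avoiders-count recognizes

-- Pattern 1 2 ⋯ m d

module PatternB (m d : ℕ) (1≤d : 1 ≤ d) (d≤m : d ≤ m) where

  e : ℕ
  e = m ∸ d

  d+e≡m : d + e ≡ m
  d+e≡m = m+[n∸m]≡n d≤m

  1≤m : 1 ≤ m
  1≤m = ≤-trans 1≤d d≤m

  -- x completes 1 2 ⋯ m d exactly when x ≥ d and the values x−d+1, …, x+e already occur.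
  allowed : ℕ → ℕ → Bool
  allowed M x = not ((d ≤ᵇ x) ∧ (x + e ≤ᵇ M))

  open CanonicalAutomaton {ℕ} id allowed _⊔_ (λ _ _ → refl)

  allowed-small : ∀ {M x} → x < d → allowed M x ≡ true
  allowed-small x<d rewrite >⇒≤ᵇ≡false x<d = refl

  allowed-large : ∀ {M x} → M < x + e → allowed M x ≡ true
  allowed-large {M} {x} M<x+e rewrite >⇒≤ᵇ≡false M<x+e with d ≤ᵇ x
  ... | true = refl
  ... | false = refl

  forbidden : ∀ {M x} → d ≤ x → x + e ≤ M → allowed M x ≡ false
  forbidden d≤x x+e≤M rewrite ≤⇒≤ᵇ≡true d≤x | ≤⇒≤ᵇ≡true x+e≤M = refl

  forbidden⁻ : ∀ {M x} → allowed M x ≡ false → d ≤ x × x + e ≤ M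
  forbidden⁻ {M} {x} f with d ≤ᵇ x in p | x + e ≤ᵇ M in q
  ... | true | true = ≤ᵇ≡true⇒≤ p , ≤ᵇ≡true⇒≤ q
  ... | true | false = contradiction f λ ()
  ... | false | _ = contradiction f λ ()

  allowed-unsaturated : ∀ {M x} → M < m → allowed M x ≡ true
  allowed-unsaturated {M} {x} M<m with d ≤? x
  ... | yes d≤x = allowed-large (<-≤-trans M<m (subst (_≤ x + e) d+e≡m (+-monoˡ-≤ e d≤x)))
  ... | no d≰x = allowed-small (≰⇒> d≰x)

  accepted-avoids : ∀ w → accepts 0 w ≡ true → ¬ Occurs w (patB m d)
  accepted-avoids w acc (s , s⊆w , iso) with occurrence-split m [ d ] {s} iso
  ... | v , [] , _ , _ , () , _
  ... | v , y ∷ _ ∷ _ , _ , _ , () , _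
  ... | v , y ∷ [] , refl , ∣v∣ , _ , consistent with split-⊆ v s⊆w
  ...   | u , r , refl , v⊆u , _
    with letter-after-run [] ∣v∣ consistent (λ a∈ → accepted-positive 0 _ acc (∈-++⁺ˡ (⊆-lookup v⊆u a∈))) 1≤d d+e≡m
  ...     | d≤y , b , b-plays , y+e≤b =
    contradiction (trans (sym (accepts⇒allowed 0 u y r acc)) (forbidden d≤y y+e≤max)) λ ()
    where
    y+e≤max : y + e ≤ maxOf 0 u
    y+e≤max = ≤-trans y+e≤b (∈⇒≤maxOf 0 u (⊆-lookup v⊆u (proj₁ (∈-zip⁻ v (incr m) b-plays))))

  rejected-contains : ∀ w → isCanonical w ≡ true → accepts 0 w ≡ false → Occurs w (patB m d)
  rejected-contains w c rej with rejected-split 0 w c rej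
  ... | u , x , r , refl , _ , f , c-ux with forbidden⁻ f
  ...   | d≤x , x+e≤max =
    staircase-then-letter u r x (x ∸ d) m d (canonical-++⁻ 0 u [ x ] c-ux)
      (subst (_≤ maxOf 0 u) x+e≡m+k x+e≤max) (m+[n∸m]≡n d≤x)
    where
    x+e≡m+k : x + e ≡ m + (x ∸ d)
    x+e≡m+k = trans (x+c≡d+c+[x∸d] e d≤x) (cong (_+ (x ∸ d)) d+e≡m)

  recognizes : Recognizes 0 (patB m d)
  recognizes = record { starts-empty = refl ; accepted-avoids = accepted-avoids ; rejected-contains = rejected-contains }

  countVia-new : ∀ M L → countVia M (suc M) L ≡ count (suc M) L
  countVia-new M L = trans (countVia-allowed L (allowed-large (s≤s (m≤m+n M e)))) (cong (λ b → count b L) (m≤n⇒m⊔n≡n (n≤1+n M)))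

  count-unsaturated : ∀ M L → M < m → count M (suc L) ≡ M * count M L + count (suc M) L
  count-unsaturated M L M<m = trans (count-old-letters M L old) (cong (M * count M L +_) (countVia-new M L))
    where
    old : ∀ i → i < M → countVia M (suc i) L ≡ count M L
    old i i<M = trans (countVia-allowed L (allowed-unsaturated M<m)) (cong (λ b → count b L) (m≥n⇒m⊔n≡m i<M))

  -- Once M ≥ m − 1, exactly the letters d, …, M − e are forbidden, leaving m − 1 old letters.
  allowedOld-saturated : ∀ M → m ∸ 1 ≤ M → sumBelow (λ i → if allowed M (suc i) then 1 else 0) M ≡ m ∸ 1
  allowedOld-saturated M q≤M with m≤n⇒∃[o]m+o≡n q≤M
  ... | o , q+o≡M = begin
    sumBelow χ M                                                   ≡⟨ cong (sumBelow χ) M≡a+[o+e] ⟩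
    sumBelow χ (a + (o + e))                                       ≡⟨ sumBelow-+₃ χ a o e ⟩
    sumBelow χ a + (sumBelow (λ j → χ (a + j)) o + sumBelow (λ j → χ (a + (o + j))) e)
      ≡⟨ cong₂ _+_ (sumBelow-const χ a 1 below-d) (cong₂ _+_ (sumBelow-const _ o 0 forbidden-block) (sumBelow-const _ e 1 above)) ⟩
    a * 1 + (o * 0 + e * 1)                                        ≡⟨ cong₂ (λ x y → x + (y + e * 1)) (*-identityʳ a) (*-zeroʳ o) ⟩
    a + e * 1                                                      ≡⟨ cong (a +_) (*-identityʳ e) ⟩
    a + e                                                          ≡⟨ a+e≡q ⟩
    m ∸ 1                                                          ∎
    where
    open ≡-Reasoning
    χ : ℕ → ℕ
    χ i = if allowed M (suc i) then 1 else 0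
    a : ℕ
    a = d ∸ 1
    1+a≡d : suc a ≡ d
    1+a≡d = m+[n∸m]≡n 1≤d
    a+e≡q : a + e ≡ m ∸ 1
    a+e≡q = cong (_∸ 1) (trans (cong (_+ e) 1+a≡d) d+e≡m)
    M≡a+[o+e] : M ≡ a + (o + e)
    M≡a+[o+e] = begin
      M              ≡⟨ sym q+o≡M ⟩
      m ∸ 1 + o      ≡⟨ cong (_+ o) (sym a+e≡q) ⟩
      a + e + o      ≡⟨ +-assoc a e o ⟩
      a + (e + o)    ≡⟨ cong (a +_) (+-comm e o) ⟩
      a + (o + e)    ∎
    below-d : ∀ i → i < a → χ i ≡ 1
    below-d i i<a rewrite allowed-small {M} (subst (suc i <_) 1+a≡d (s≤s i<a)) = refl
    in-block : ∀ j → j < o → suc (a + j) + e ≤ M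
    in-block j j<o = subst (suc (a + j) + e ≤_) (sym M≡a+[o+e])
      (subst (_≤ a + (o + e)) (trans (+-suc a (j + e)) (cong suc (sym (+-assoc a j e)))) (+-monoʳ-≤ a (+-monoˡ-≤ e j<o)))
    past-block : ∀ j → M < suc (a + (o + j)) + e
    past-block j = subst (_< suc (a + (o + j)) + e) (sym M≡a+[o+e])
      (s≤s (≤-trans (+-monoʳ-≤ a (+-monoˡ-≤ e (m≤m+n o j))) (≤-reflexive (sym (+-assoc a (o + j) e)))))
    forbidden-block : ∀ j → j < o → χ (a + j) ≡ 0
    forbidden-block j j<o
      rewrite forbidden {M} {suc (a + j)} (subst (_≤ suc (a + j)) 1+a≡d (s≤s (m≤m+n a j))) (in-block j j<o) = refl
    above : ∀ j → j < e → χ (a + (o + j)) ≡ 1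
    above j _ rewrite allowed-large {M} {suc (a + (o + j))} (past-block j) = refl

  count-saturated : ∀ L M → m ∸ 1 ≤ M → count M L ≡ m ^ L
  count-saturated zero M _ = refl
  count-saturated (suc L) M q≤M = begin
    count M (suc L)                                              ≡⟨ count-suc M L ⟩
    sumBelow (λ i → countVia M (suc i) L) M + countVia M (suc M) L
      ≡⟨ cong₂ _+_ (sumBelow-cong _ _ M old) (trans (countVia-new M L) (count-saturated L (suc M) (≤-trans q≤M (n≤1+n M)))) ⟩
    sumBelow (λ i → if allowed M (suc i) then m ^ L else 0) M + m ^ L
      ≡⟨ cong (_+ m ^ L) (sumBelow-if (λ i → allowed M (suc i)) (m ^ L) M) ⟩
    sumBelow (λ i → if allowed M (suc i) then 1 else 0) M * m ^ L + m ^ L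
      ≡⟨ cong (λ n → n * m ^ L + m ^ L) (allowedOld-saturated M q≤M) ⟩
    (m ∸ 1) * m ^ L + m ^ L                                      ≡⟨ [m∸1]*n+n≡m*n (m ^ L) 1≤m ⟩
    m ^ suc L                                                    ∎
    where
    open ≡-Reasoning
    old : ∀ i → i < M → countVia M (suc i) L ≡ (if allowed M (suc i) then m ^ L else 0)
    old i i<M = cong (λ n → if allowed M (suc i) then n else 0)
      (trans (cong (λ b → count b L) (m≥n⇒m⊔n≡m i<M)) (count-saturated L M q≤M))

  countedBy : CountedBy m (patB m d)
  countedBy = count , extension , avoiders-count recognizes
    where
    extension : ExtensionCount m count
    extension = record
      { empty = λ _ → refl
      ; unsaturated = λ M L M<q → count-unsaturated M L (<-≤-trans M<q (m∸n≤m m 1))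
      ; saturated = λ L → count-saturated L (m ∸ 1) ≤-refl
      }

-- Counts for pattern 1 2 ⋯ (m−1) d m, with P = m − 2: withThreshold s L from a state whose
-- threshold is (m − 1) + s, noThreshold r L from a state with (m − 1) + r blocks and no threshold.
module ThresholdRecurrences (P : ℕ) where

  withThreshold : ℕ → ℕ → ℕ
  withThreshold s zero = 1
  withThreshold s (suc L) = suc P * withThreshold s L + sumBelow (λ j → withThreshold j L) s

  noThreshold : ℕ → ℕ → ℕ
  noThreshold r zero = 1
  noThreshold r (suc L) = P * noThreshold r L + noThreshold (suc r) L + sumBelow (λ j → withThreshold j L) (suc r)

  private
    isolate-B+C : ∀ P A B C D E → P * A + B + (E + D + C) + (suc P * D + E) ≡ P * A + (E + D) + suc P * D + E + (B + C)
    isolate-B+C = solve-∀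
    factor-A+D : ∀ P A D E → P * A + (E + D) + suc P * D + E + 2 * A ≡ P * (A + D) + 2 * (A + (E + D))
    factor-A+D = solve-∀
    factor-2 : ∀ P A D E F → P * (2 * F) + 2 * (A + (E + D)) ≡ 2 * (P * F + A + (E + D))
    factor-2 = solve-∀

  noThreshold-suc : ∀ L r → noThreshold (suc r) L + withThreshold r L ≡ 2 * noThreshold r L
  noThreshold-suc zero r = refl
  noThreshold-suc (suc L) r = begin
    noThreshold (suc r) (suc L) + withThreshold r (suc L)
      ≡⟨ cong (λ Σ₂ → P * A + B + Σ₂ + (suc P * D + E)) (trans (sumBelow-suc f (suc r)) (cong (_+ C) (sumBelow-suc f r))) ⟩
    P * A + B + (E + D + C) + (suc P * D + E)      ≡⟨ isolate-B+C P A B C D E ⟩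
    P * A + (E + D) + suc P * D + E + (B + C)      ≡⟨ cong (P * A + (E + D) + suc P * D + E +_) (noThreshold-suc L (suc r)) ⟩
    P * A + (E + D) + suc P * D + E + 2 * A        ≡⟨ factor-A+D P A D E ⟩
    P * (A + D) + 2 * (A + (E + D))                ≡⟨ cong (λ n → P * n + 2 * (A + (E + D))) (noThreshold-suc L r) ⟩
    P * (2 * F) + 2 * (A + (E + D))                ≡⟨ factor-2 P A D E F ⟩
    2 * (P * F + A + (E + D))                      ≡⟨ cong (λ n → 2 * (P * F + A + n)) (sym (sumBelow-suc f r)) ⟩
    2 * noThreshold r (suc L)                      ∎
    where
    open ≡-Reasoning
    f : ℕ → ℕ
    f = λ j → withThreshold j L
    A : ℕ
    A = noThreshold (suc r) L
    B : ℕ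
    B = noThreshold (suc (suc r)) L
    C : ℕ
    C = withThreshold (suc r) L
    D : ℕ
    D = withThreshold r L
    E : ℕ
    E = sumBelow f r
    F : ℕ
    F = noThreshold r L

  noThreshold-zero : ∀ L → noThreshold 0 L ≡ (2 + P) ^ L
  noThreshold-zero zero = refl
  noThreshold-zero (suc L) = begin
    P * noThreshold 0 L + noThreshold 1 L + (withThreshold 0 L + 0)
      ≡⟨ cong (P * noThreshold 0 L + noThreshold 1 L +_) (+-identityʳ _) ⟩
    P * noThreshold 0 L + noThreshold 1 L + withThreshold 0 L        ≡⟨ +-assoc (P * noThreshold 0 L) _ _ ⟩
    P * noThreshold 0 L + (noThreshold 1 L + withThreshold 0 L)      ≡⟨ cong (P * noThreshold 0 L +_) (noThreshold-suc L 0) ⟩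
    P * noThreshold 0 L + 2 * noThreshold 0 L                        ≡⟨ sym (*-distribʳ-+ (noThreshold 0 L) P 2) ⟩
    (P + 2) * noThreshold 0 L                                        ≡⟨ cong₂ _*_ (+-comm P 2) (noThreshold-zero L) ⟩
    (2 + P) ^ suc L                                                  ∎
    where open ≡-Reasoning

-- Pattern 1 2 ⋯ (m−1) d m

module PatternC (m d : ℕ) (1≤d : 1 ≤ d) (d≤q : d ≤ m ∸ 1) (2≤m : 2 ≤ m) where

  q : ℕ
  q = m ∸ 1

  c : ℕ
  c = q ∸ d

  d+c≡q : d + c ≡ q
  d+c≡q = m+[n∸m]≡n d≤q

  1+q≡m : suc q ≡ m
  1+q≡m = m+[n∸m]≡n (≤-trans (s≤s z≤n) 2≤m)

  -- x can play d in an occurrence of 1 2 ⋯ (m−1) d: the values x−d+1, …, x+c already occur.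
  activates : ℕ → ℕ → Bool
  activates M x = (d ≤ᵇ x) ∧ (x + c ≤ᵇ M)

  tighten : Maybe ℕ → ℕ → ℕ
  tighten nothing v = v
  tighten (just t) v = t ⊓ v

  below : Maybe ℕ → ℕ → Bool
  below nothing x = true
  below (just t) x = x ≤ᵇ t

  -- The threshold is the least x + c over the letters x activated so far: a later letter
  -- above it would play m.
  thresholdAfter : ℕ → Maybe ℕ → ℕ → Maybe ℕ
  thresholdAfter M t x = if activates M x then just (tighten t (x + c)) else t

  State : Set
  State = ℕ × Maybe ℕ

  step : State → ℕ → State
  step (M , t) x = M ⊔ x , thresholdAfter M t x

  open CanonicalAutomaton {State} proj₁ (λ s x → below (proj₂ s) x) step (λ _ _ → refl)

  start : State
  start = 0 , nothing

  tighten≤ : ∀ t v → tighten t v ≤ v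
  tighten≤ nothing v = ≤-refl
  tighten≤ (just t) v = m⊓n≤n t v

  thresholdAfter-activated : ∀ {M t x} → activates M x ≡ true → thresholdAfter M t x ≡ just (tighten t (x + c))
  thresholdAfter-activated a rewrite a = refl

  thresholdAfter-inactive : ∀ {M t x} → activates M x ≡ false → thresholdAfter M t x ≡ t
  thresholdAfter-inactive a rewrite a = refl

  threshold-bounds : ∀ u {M t} z r → accepts (M , just t) (u ++ z ∷ r) ≡ true → z ≤ t
  threshold-bounds [] {M} z r acc = ≤ᵇ≡true⇒≤ (proj₂ (∧≡true⁻ {legal M z} (proj₁ (∧≡true⁻ acc))))
  threshold-bounds (x ∷ u) {M} {t} z r acc with activates M x
  ... | true = ≤-trans (threshold-bounds u z r (proj₂ (∧≡true⁻ {admissible (M , just t) x} acc))) (m⊓n≤m t (x + c))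
  ... | false = threshold-bounds u z r (proj₂ (∧≡true⁻ {admissible (M , just t) x} acc))

  accepted-avoids : ∀ w → accepts start w ≡ true → ¬ Occurs w (patC m d)
  accepted-avoids w acc (s , s⊆w , iso) with occurrence-split q (d ∷ m ∷ []) {s} iso
  ... | v , [] , _ , _ , () , _
  ... | v , _ ∷ [] , _ , _ , () , _
  ... | v , _ ∷ _ ∷ _ ∷ _ , _ , _ , () , _
  ... | v , y ∷ z ∷ [] , refl , ∣v∣ , _ , consistent with split-⊆ v s⊆w
  ...   | u , r′ , refl , v⊆u , [z]⊆r′ with split-⊆ [] [z]⊆r′
  ...     | u′ , r , refl , _ , _
    with letter-after-run [ (z , m) ] ∣v∣ consistent (λ a∈ → accepted-positive start _ acc (∈-++⁺ˡ (⊆-lookup v⊆u a∈))) 1≤d d+c≡q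
  ...       | d≤y , b , b-plays , y+c≤b = <⇒≱ b<z (≤-trans z≤y+c y+c≤b)
    where
    b<z : b < z
    b<z = sameOrder-< (consistent (∈-++⁺ˡ b-plays) (∈-++⁺ʳ _ (there (here refl)))) (subst (q <_) 1+q≡m (n<1+n q))
    y+c≤max : y + c ≤ proj₁ (run start u)
    y+c≤max = subst (y + c ≤_) (sym (blocks-run start u))
                    (≤-trans y+c≤b (∈⇒≤maxOf 0 u (⊆-lookup v⊆u (proj₁ (∈-zip⁻ v (incr q) b-plays)))))
    S : State
    S = run start u
    activated : activates (proj₁ S) y ≡ true
    activated = ∧≡true⁺ (≤⇒≤ᵇ≡true d≤y) (≤⇒≤ᵇ≡true y+c≤max)
    acc-after-y : accepts (step S y) (u′ ++ z ∷ r) ≡ true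
    acc-after-y = proj₂ (∧≡true⁻ {admissible S y} (proj₂ (accepts-++⁻ start u _ acc)))
    z≤y+c : z ≤ y + c
    z≤y+c = ≤-trans (threshold-bounds u′ z r (subst (λ t → accepts (proj₁ S ⊔ y , t) (u′ ++ z ∷ r) ≡ true)
                                                    (thresholdAfter-activated activated) acc-after-y))
                    (tighten≤ (proj₂ S) (y + c))

  Witness : List ℕ → ℕ → Set
  Witness p t = ∃ λ y → t ≡ y + c × d ≤ y × map (_+ (y ∸ d)) (incr q) ++ [ y ] ⊆ p

  Invariant : List ℕ → Set
  Invariant p = ∀ t → proj₂ (run start p) ≡ just t → Witness p t

  thresholdAfter-cases : ∀ M T x t → thresholdAfter M T x ≡ just t →
    T ≡ just t ⊎ (activates M x ≡ true × t ≡ x + c)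
  thresholdAfter-cases M T x t t≡ with activates M x
  ... | false = inj₁ t≡
  thresholdAfter-cases M nothing x t refl | true = inj₂ (refl , refl)
  thresholdAfter-cases M (just t₀) x t refl | true with ⊓-sel t₀ (x + c)
  ... | inj₁ t₀⊓≡t₀ = inj₁ (cong just (sym t₀⊓≡t₀))
  ... | inj₂ t₀⊓≡x+c = inj₂ (refl , t₀⊓≡x+c)

  invariant-snoc : ∀ p x → canonicalFrom 0 (p ++ [ x ]) ≡ true → Invariant p → Invariant (p ++ [ x ])
  invariant-snoc p x c-px inv t t≡
    with thresholdAfter-cases (proj₁ S) (proj₂ S) x t (trans (sym (cong proj₂ (foldl-++ step start p [ x ]))) t≡)
    where S = run start p
  ... | inj₁ T≡ = let y , t≡y+c , d≤y , τ = inv t T≡ in y , t≡y+c , d≤y , ++⁺ʳ [ x ] τ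
  ... | inj₂ (a , refl) with ∧≡true⁻ {d ≤ᵇ x} a
  ...   | d≤x , x+c≤max = x , refl , ≤ᵇ≡true⇒≤ d≤x ,
    ++⁺ (staircase⊆canonical p (x ∸ d) q (canonical-++⁻ 0 p [ x ] c-px) q+k≤max) (refl ∷ [])
    where
    q+k≤max : q + (x ∸ d) ≤ maxOf 0 p
    q+k≤max = subst₂ _≤_ (trans (x+c≡d+c+[x∸d] {d} {x} c (≤ᵇ≡true⇒≤ d≤x)) (cong (_+ (x ∸ d)) d+c≡q)) (blocks-run start p)
                     (≤ᵇ≡true⇒≤ {x + c} x+c≤max)

  invariant-++ : ∀ u p → Invariant p → canonicalFrom 0 (p ++ u) ≡ true → Invariant (p ++ u)
  invariant-++ [] p inv _ = subst Invariant (sym (++-identityʳ p)) inv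
  invariant-++ (x ∷ u) p inv can = subst Invariant (++-assoc p [ x ] u)
    (invariant-++ u (p ++ [ x ]) (invariant-snoc p x (canonical-++⁻ 0 (p ++ [ x ]) u c′) inv) c′)
    where
    c′ : canonicalFrom 0 ((p ++ [ x ]) ++ u) ≡ true
    c′ = subst (λ w → canonicalFrom 0 w ≡ true) (sym (++-assoc p [ x ] u)) can

  witness-then-letter : ∀ u r x y → d ≤ y → y + c < x → map (_+ (y ∸ d)) (incr q) ++ [ y ] ⊆ u →
    Occurs (u ++ x ∷ r) (patC m d)
  witness-then-letter u r x y d≤y y+c<x τ =
    map g (patC m d) , subst (_⊆ u ++ x ∷ r) (sym g-image) (++⁺ τ (refl ∷ minimum r)) , orderIso-map g-mono (patC m d)
    where
    k : ℕ
    k = y ∸ d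
    q+k≡y+c : q + k ≡ y + c
    q+k≡y+c = trans (cong (_+ k) (sym d+c≡q)) (sym (x+c≡d+c+[x∸d] c d≤y))
    m≤x : m ≤ x
    m≤x = subst (_≤ x) 1+q≡m (≤-trans (s≤s (≤-trans (m≤m+n q k) (≤-reflexive q+k≡y+c))) y+c<x)
    -- Shift 1, …, q onto the witness staircase and m onto x.
    g : ℕ → ℕ
    g i = if i ≤ᵇ q then i + k else i + (x ∸ m)
    g-mono : g Preserves _<_ ⟶ _<_
    g-mono {i} {j} i<j with i ≤ᵇ q in i≤q | j ≤ᵇ q in j≤q
    ... | true | true = +-monoˡ-< k i<j
    ... | false | false = +-monoˡ-< (x ∸ m) i<j
    ... | true | false = ≤-trans (s≤s (≤-trans (+-monoˡ-≤ k (≤ᵇ≡true⇒≤ i≤q)) (≤-reflexive q+k≡y+c)))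
                           (≤-trans y+c<x (≤-trans (≤-reflexive (sym (m+[n∸m]≡n m≤x)))
                                                   (+-monoˡ-≤ (x ∸ m) (subst (_≤ j) 1+q≡m (≤ᵇ≡false⇒> j≤q)))))
    ... | false | true = contradiction (≤-trans (<⇒≤ i<j) (≤ᵇ≡true⇒≤ j≤q)) (<⇒≱ (≤ᵇ≡false⇒> i≤q))
    g-image : map g (patC m d) ≡ (map (_+ k) (incr q) ++ [ y ]) ++ [ x ]
    g-image = begin
      map g (incr q ++ d ∷ m ∷ [])                   ≡⟨ map-++ g (incr q) (d ∷ m ∷ []) ⟩
      map g (incr q) ++ g d ∷ g m ∷ []
        ≡⟨ cong₂ _++_ (map-cong-local (tabulate on-staircase)) (cong₂ (λ a b → a ∷ b ∷ []) g-d g-m) ⟩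
      map (_+ k) (incr q) ++ y ∷ x ∷ []              ≡⟨ sym (++-assoc (map (_+ k) (incr q)) [ y ] [ x ]) ⟩
      (map (_+ k) (incr q) ++ [ y ]) ++ [ x ]        ∎
      where
      open ≡-Reasoning
      on-staircase : ∀ {i} → i ∈ incr q → g i ≡ i + k
      on-staircase i∈ rewrite ≤⇒≤ᵇ≡true (proj₂ (∈-incr⁻ q i∈)) = refl
      g-d : g d ≡ y
      g-d rewrite ≤⇒≤ᵇ≡true d≤q = m+[n∸m]≡n d≤y
      g-m : g m ≡ x
      g-m rewrite >⇒≤ᵇ≡false {m} {q} (subst (q <_) 1+q≡m (n<1+n q)) = m+[n∸m]≡n m≤x

  rejected-contains : ∀ w → isCanonical w ≡ true → accepts start w ≡ false → Occurs w (patC m d)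
  rejected-contains w can rej with rejected-split start w can rej
  ... | u , x , r , refl , _ , f , c-ux with proj₂ (run start u) in T≡
  ...   | nothing = contradiction f λ ()
  ...   | just t with invariant-++ u [] (λ _ ()) (canonical-++⁻ 0 u [ x ] c-ux) t T≡
  ...     | y , refl , d≤y , τ = witness-then-letter u r x y d≤y (≤ᵇ≡false⇒> f) τ

  recognizes : Recognizes start (patC m d)
  recognizes = record { starts-empty = refl ; accepted-avoids = accepted-avoids ; rejected-contains = rejected-contains }

  open ThresholdRecurrences (q ∸ 1)

  a : ℕ
  a = d ∸ 1

  1+a≡d : suc a ≡ d
  1+a≡d = m+[n∸m]≡n 1≤d

  a+[1+c]≡q : a + suc c ≡ q
  a+[1+c]≡q = trans (+-suc a c) (trans (cong (_+ c) 1+a≡d) d+c≡q)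

  a+c≡q∸1 : a + c ≡ q ∸ 1
  a+c≡q∸1 = cong (_∸ 1) (trans (sym (+-suc a c)) a+[1+c]≡q)

  [1+a+j]+c≡q+j : ∀ j → suc (a + j) + c ≡ q + j
  [1+a+j]+c≡q+j j = begin
    suc (a + j) + c   ≡⟨ cong (λ n → n + j + c) 1+a≡d ⟩
    d + j + c         ≡⟨ +-assoc d j c ⟩
    d + (j + c)       ≡⟨ cong (d +_) (+-comm j c) ⟩
    d + (c + j)       ≡⟨ sym (+-assoc d c j) ⟩
    d + c + j         ≡⟨ cong (_+ j) d+c≡q ⟩
    q + j             ∎
    where open ≡-Reasoning

  d≤1+a+j : ∀ j → d ≤ suc (a + j)
  d≤1+a+j j = subst (_≤ suc (a + j)) 1+a≡d (s≤s (m≤m+n a j))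

  inactive : ∀ {M x} → (d ≤ x → M < x + c) → activates M x ≡ false
  inactive {M} {x} M<x+c with d ≤ᵇ x in d≤x
  ... | false = refl
  ... | true = >⇒≤ᵇ≡false (M<x+c (≤ᵇ≡true⇒≤ d≤x))

  inactive-small : ∀ {M x} → x < d → activates M x ≡ false
  inactive-small x<d = inactive (λ d≤x → contradiction d≤x (<⇒≱ x<d))

  active : ∀ {M x} → d ≤ x → x + c ≤ M → activates M x ≡ true
  active d≤x x+c≤M rewrite ≤⇒≤ᵇ≡true d≤x | ≤⇒≤ᵇ≡true x+c≤M = refl

  thresholdAfter-above : ∀ {M t x} → t ≤ x + c → thresholdAfter M (just t) x ≡ just t
  thresholdAfter-above {M} {t} {x} t≤x+c with activates M x
  ... | true = cong just (m≤n⇒m⊓n≡m t≤x+c)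
  ... | false = refl

  countVia-keep : ∀ {M t x t′} L → below t x ≡ true → x ≤ M → thresholdAfter M t x ≡ t′ →
    countVia (M , t) x L ≡ count (M , t′) L
  countVia-keep L b x≤M t′≡ rewrite b = cong₂ (λ M′ t″ → count (M′ , t″) L) (m≥n⇒m⊔n≡m x≤M) t′≡

  private
    collect-W : ∀ a c W Σ → a * W + (Σ + suc c * W) ≡ suc (a + c) * W + Σ
    collect-W = solve-∀
    collect-U : ∀ a c U U′ Σ → a * U + (Σ + c * U) + U′ ≡ (a + c) * U + U′ + Σ
    collect-U = solve-∀

  q+s≡a+[s+1+c] : ∀ s → q + s ≡ a + (s + suc c)
  q+s≡a+[s+1+c] s = begin
    q + s              ≡⟨ cong (_+ s) (sym a+[1+c]≡q) ⟩
    a + suc c + s      ≡⟨ +-assoc a (suc c) s ⟩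
    a + (suc c + s)    ≡⟨ cong (a +_) (+-comm (suc c) s) ⟩
    a + (s + suc c)    ∎
    where open ≡-Reasoning

  q+r≡a+[1+r+c] : ∀ r → q + r ≡ a + (suc r + c)
  q+r≡a+[1+r+c] r = trans (q+s≡a+[s+1+c] r) (cong (a +_) (+-suc r c))

  small-keeps : ∀ {M t} L i → i < a → suc i ≤ M → below t (suc i) ≡ true → countVia (M , t) (suc i) L ≡ count (M , t) L
  small-keeps {M} L i i<a 1+i≤M b =
    countVia-keep L b 1+i≤M (thresholdAfter-inactive {M} (inactive-small {M} (subst (suc i <_) 1+a≡d (s≤s i<a))))

  above-threshold-forbidden : ∀ {M t} L i → t ≤ i → countVia (M , just t) (suc i) L ≡ 0
  above-threshold-forbidden L i t≤i = countVia-forbidden L (>⇒≤ᵇ≡false (s≤s t≤i))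

  activating-tightens : ∀ {M t} L j → q + j ≤ M → q + j < t → countVia (M , just t) (suc (a + j)) L ≡ count (M , just (q + j)) L
  activating-tightens {M} {t} L j q+j≤M q+j<t = countVia-keep L (≤⇒≤ᵇ≡true x≤t) (≤-trans (m≤m+n x c) x+c≤M) threshold
    where
    x : ℕ
    x = suc (a + j)
    x+c≤M : x + c ≤ M
    x+c≤M = subst (_≤ M) (sym ([1+a+j]+c≡q+j j)) q+j≤M
    x+c≤t : x + c ≤ t
    x+c≤t = subst (_≤ t) (sym ([1+a+j]+c≡q+j j)) (<⇒≤ q+j<t)
    x≤t : x ≤ t
    x≤t = ≤-trans (m≤m+n x c) x+c≤t
    threshold : thresholdAfter M (just t) x ≡ just (q + j)
    threshold = begin
      thresholdAfter M (just t) x   ≡⟨ thresholdAfter-activated {M} (active (d≤1+a+j j) x+c≤M) ⟩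
      just (t ⊓ (x + c))            ≡⟨ cong just (m≥n⇒m⊓n≡n x+c≤t) ⟩
      just (x + c)                  ≡⟨ cong just ([1+a+j]+c≡q+j j) ⟩
      just (q + j)                  ∎
      where open ≡-Reasoning

  activating-sets : ∀ {M} L j → q + j ≤ M → countVia (M , nothing) (suc (a + j)) L ≡ count (M , just (q + j)) L
  activating-sets {M} L j q+j≤M = countVia-keep {M} {nothing} L refl (≤-trans (m≤m+n x c) x+c≤M)
    (trans (thresholdAfter-activated {M} {nothing} (active (d≤1+a+j j) x+c≤M)) (cong just ([1+a+j]+c≡q+j j)))
    where
    x : ℕ
    x = suc (a + j)
    x+c≤M : x + c ≤ M
    x+c≤M = subst (_≤ M) (sym ([1+a+j]+c≡q+j j)) q+j≤M

  large-keeps-threshold : ∀ {M} L s j → j < suc c → q + s ≤ M →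
    countVia (M , just (q + s)) (suc (a + (s + j))) L ≡ count (M , just (q + s)) L
  large-keeps-threshold {M} L s j j≤c t≤M =
    countVia-keep L (≤⇒≤ᵇ≡true x≤t) (≤-trans x≤t t≤M) (thresholdAfter-above {M} (subst (q + s ≤_) (sym x+c≡t+j) (m≤m+n _ j)))
    where
    x : ℕ
    x = suc (a + (s + j))
    x+c≡t+j : x + c ≡ q + s + j
    x+c≡t+j = trans ([1+a+j]+c≡q+j (s + j)) (sym (+-assoc q s j))
    x≤t : x ≤ q + s
    x≤t = +-cancelʳ-≤ c x (q + s) (subst (_≤ q + s + c) (sym x+c≡t+j) (+-monoʳ-≤ (q + s) (≤-pred j≤c)))

  large-inactive : ∀ L r j → j < c → countVia (q + r , nothing) (suc (a + (suc r + j))) L ≡ count (q + r , nothing) L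
  large-inactive L r j j<c = countVia-keep L refl x≤M (thresholdAfter-inactive {M} (inactive (λ _ → M<x+c)))
    where
    M : ℕ
    M = q + r
    x : ℕ
    x = suc (a + (suc r + j))
    x+c≡1+M+j : x + c ≡ suc M + j
    x+c≡1+M+j = trans ([1+a+j]+c≡q+j (suc r + j)) (trans (sym (+-assoc q (suc r) j)) (cong (_+ j) (+-suc q r)))
    M<x+c : M < x + c
    M<x+c = subst (M <_) (sym x+c≡1+M+j) (m≤m+n (suc M) j)
    x≤M : x ≤ M
    x≤M = +-cancelʳ-≤ c x M (subst (_≤ M + c) (sym x+c≡1+M+j) (subst (_≤ M + c) (+-suc M j) (+-monoʳ-≤ M j<c)))

  new-block-inactive : ∀ {M} L → countVia (M , nothing) (suc M) L ≡ count (suc M , nothing) L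
  new-block-inactive {M} L = cong₂ (λ M′ t → count (M′ , t) L) (m≤n⇒m⊔n≡n (n≤1+n M))
                                   (thresholdAfter-inactive {M} (inactive (λ _ → s≤s (m≤m+n M c))))

  count-withThreshold : ∀ L s M → q + s ≤ M → count (M , just (q + s)) L ≡ withThreshold s L
  count-withThreshold zero s M _ = refl
  count-withThreshold (suc L) s M t≤M = begin
    count (M , just t) (suc L)                   ≡⟨ count-suc (M , just t) L ⟩
    sumBelow G M + G M                           ≡⟨ cong₂ _+_ (sumBelow-vanishing G t M t≤M (above-threshold-forbidden L))
                                                              (above-threshold-forbidden L M t≤M) ⟩
    sumBelow G t + 0                             ≡⟨ +-identityʳ _ ⟩
    sumBelow G t                                 ≡⟨ cong (sumBelow G) (q+s≡a+[s+1+c] s) ⟩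
    sumBelow G (a + (s + suc c))                 ≡⟨ sumBelow-+₃ G a s (suc c) ⟩
    sumBelow G a + (sumBelow (λ j → G (a + j)) s + sumBelow (λ j → G (a + (s + j))) (suc c))
      ≡⟨ cong₂ _+_ (sumBelow-const G a W small) (cong₂ _+_ (sumBelow-cong _ _ s activating) (sumBelow-const _ (suc c) W large)) ⟩
    a * W + (Σ + suc c * W)                      ≡⟨ collect-W a c W Σ ⟩
    suc (a + c) * W + Σ                          ≡⟨ cong (λ n → suc n * W + Σ) a+c≡q∸1 ⟩
    withThreshold s (suc L)                      ∎
    where
    open ≡-Reasoning
    t : ℕ
    t = q + s
    G : ℕ → ℕ
    G i = countVia (M , just t) (suc i) L
    W : ℕ
    W = withThreshold s L
    Σ : ℕ
    Σ = sumBelow (λ j → withThreshold j L) s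
    IH : count (M , just t) L ≡ W
    IH = count-withThreshold L s M t≤M
    small : ∀ i → i < a → G i ≡ W
    small i i<a = trans (small-keeps L i i<a (≤-trans 1+i≤t t≤M) (≤⇒≤ᵇ≡true 1+i≤t)) IH
      where
      1+i≤t : suc i ≤ t
      1+i≤t = ≤-trans (≤-trans i<a (<⇒≤ (subst (a <_) 1+a≡d (n<1+n a)))) (≤-trans d≤q (m≤m+n q s))
    activating : ∀ j → j < s → G (a + j) ≡ withThreshold j L
    activating j j<s = trans (activating-tightens L j (≤-trans (<⇒≤ q+j<t) t≤M) q+j<t)
                             (count-withThreshold L j M (≤-trans (<⇒≤ q+j<t) t≤M))
      where
      q+j<t : q + j < t
      q+j<t = +-monoʳ-< q j<s
    large : ∀ j → j < suc c → G (a + (s + j)) ≡ W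
    large j j≤c = trans (large-keeps-threshold L s j j≤c t≤M) IH

  count-noThreshold : ∀ L r → count (q + r , nothing) L ≡ noThreshold r L
  count-noThreshold zero r = refl
  count-noThreshold (suc L) r = begin
    count (M , nothing) (suc L)                          ≡⟨ count-suc (M , nothing) L ⟩
    sumBelow G M + G M                                   ≡⟨ cong₂ _+_ (cong (sumBelow G) (q+r≡a+[1+r+c] r)) new ⟩
    sumBelow G (a + (suc r + c)) + U′                    ≡⟨ cong (_+ U′) (sumBelow-+₃ G a (suc r) c) ⟩
    sumBelow G a + (sumBelow (λ j → G (a + j)) (suc r) + sumBelow (λ j → G (a + (suc r + j))) c) + U′
      ≡⟨ cong (_+ U′) (cong₂ _+_ (sumBelow-const G a U small)
                                (cong₂ _+_ (sumBelow-cong _ _ (suc r) activating) (sumBelow-const _ c U large))) ⟩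
    a * U + (Σ + c * U) + U′                             ≡⟨ collect-U a c U U′ Σ ⟩
    (a + c) * U + U′ + Σ                                 ≡⟨ cong (λ n → n * U + U′ + Σ) a+c≡q∸1 ⟩
    noThreshold r (suc L)                                ∎
    where
    open ≡-Reasoning
    M : ℕ
    M = q + r
    G : ℕ → ℕ
    G i = countVia (M , nothing) (suc i) L
    U : ℕ
    U = noThreshold r L
    U′ : ℕ
    U′ = noThreshold (suc r) L
    Σ : ℕ
    Σ = sumBelow (λ j → withThreshold j L) (suc r)
    IH : count (M , nothing) L ≡ U
    IH = count-noThreshold L r
    new : G M ≡ U′
    new = trans (new-block-inactive L)
                (trans (cong (λ M′ → count (M′ , nothing) L) (sym (+-suc q r))) (count-noThreshold L (suc r)))
    small : ∀ i → i < a → G i ≡ U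
    small i i<a = trans (small-keeps L i i<a 1+i≤M refl) IH
      where
      1+i≤M : suc i ≤ M
      1+i≤M = ≤-trans (≤-trans i<a (<⇒≤ (subst (a <_) 1+a≡d (n<1+n a)))) (≤-trans d≤q (m≤m+n q r))
    activating : ∀ j → j < suc r → G (a + j) ≡ withThreshold j L
    activating j j≤r = trans (activating-sets L j q+j≤M) (count-withThreshold L j M q+j≤M)
      where
      q+j≤M : q + j ≤ M
      q+j≤M = +-monoʳ-≤ q (≤-pred j≤r)
    large : ∀ j → j < c → G (a + (suc r + j)) ≡ U
    large j j<c = trans (large-inactive L r j j<c) IH

  count-unsaturated : ∀ M L → M < q → count (M , nothing) (suc L) ≡ M * count (M , nothing) L + count (suc M , nothing) L
  count-unsaturated M L M<q = trans (count-old-letters (M , nothing) L old) (cong (M * count (M , nothing) L +_) new)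
    where
    old : ∀ i → i < M → countVia (M , nothing) (suc i) L ≡ count (M , nothing) L
    old i i<M = countVia-keep L refl i<M
      (thresholdAfter-inactive {M} (inactive (λ d≤x → <-≤-trans M<q (subst (_≤ suc i + c) d+c≡q (+-monoˡ-≤ c d≤x)))))
    new : countVia (M , nothing) (suc M) L ≡ count (suc M , nothing) L
    new = new-block-inactive L

  countedBy : CountedBy m (patC m d)
  countedBy = (λ M L → count (M , nothing) L) , extension , avoiders-count recognizes
    where
    2+[q∸1]≡m : 2 + (q ∸ 1) ≡ m
    2+[q∸1]≡m = trans (cong suc (m+[n∸m]≡n (≤-trans 1≤d d≤q))) 1+q≡m
    extension : ExtensionCount m (λ M L → count (M , nothing) L)
    extension = record
      { empty = λ _ → refl
      ; unsaturated = count-unsaturated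
      ; saturated = λ L → begin
          count (q , nothing) L        ≡⟨ cong (λ M → count (M , nothing) L) (sym (+-identityʳ q)) ⟩
          count (q + 0 , nothing) L    ≡⟨ count-noThreshold L 0 ⟩
          noThreshold 0 L              ≡⟨ noThreshold-zero L ⟩
          (2 + (q ∸ 1)) ^ L            ≡⟨ cong (_^ L) 2+[q∸1]≡m ⟩
          m ^ L                        ∎
      }
      where open ≡-Reasoning

mainTheorem4 : (m : ℕ) → 2 ≤ m →
    ((d : ℕ) → 1 ≤ d → d ≤ m → Equivalent (patA m) (patB m d)) ×
    ((d : ℕ) → 1 ≤ d → d ≤ m ∸ 1 → Equivalent (patA m) (patC m d))
mainTheorem4 m 2≤m =
  (λ d 1≤d d≤m → countedBy-equivalent patA-counted (PatternB.countedBy m d 1≤d d≤m)) ,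
  (λ d 1≤d d≤m-1 → countedBy-equivalent patA-counted (PatternC.countedBy m d 1≤d d≤m-1 2≤m))
  where
  patA-counted : CountedBy m (patA m)
  patA-counted = PatternA.countedBy m (≤-trans (s≤s z≤n) 2≤m)
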